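{- Let $G=(V,E)$ and the algorithm be as described in the context. In a stable configuration, $PRwaiting(i)$ is false for every $i\in V$, where $PRwaiting(i)\equiv \exists j\in N(i): (p_i=j \text{ and } p_j\neq i \text{ and } \neg PRmarried(j))$.
   Context: Let $G=(V,E)$ be a finite simple undirected graph; each node is a process and $N(i)$ denotes the set of neighbours of $i$. Each process has an identifier from a totally ordered set; identifiers of any two distinct processes at distance at most $2$ are distinct, and comparisons such as $j>i$ between processes are comparisons of their identifiers. Each process $i$ holds variables $m_i\in\{\text{true},\text{false}\}$ and $p_i\in\{null\}\cup N(i)$; a configuration is an assignment of values to all these variables. Define the predicate $PRmarried(i)\equiv \exists j\in N(i): (p_i=j \text{ and } p_j=i)$. The algorithm consists of the following four guarded rules for each process $i$ (a rule is enabled at $i$ if its guard holds): Update: if $m_i\neq PRmarried(i)$ then $m_i:=PRmarried(i)$. Marriage: if $m_i=PRmarried(i)$ and $p_i=null$ and there is $j\in N(i)$ with $p_j=i$, then $p_i:=j$ (for such a $j$). Seduction: if $m_i=PRmarried(i)$ and $p_i=null$ and $p_k\neq i$ for all $k\in N(i)$ and there is $j\in N(i)$ with $p_j=null$, $j>i$ and $m_j=\text{false}$, then $p_i:=\max\{j\in N(i): p_j=null,\ j>i,\ m_j=\text{false}\}$. Abandonment: if $m_i=PRmarried(i)$ and $p_i=j\neq null$ and $p_j\neq i$ and ($m_j=\text{true}$ or $j\le i$), then $p_i:=null$. A process is eligible if some rule is enabled at it. A configuration is stable if no process is eligible. -}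

module Defs where

open import Level using (Level; _⊔_)
open import Data.Nat using (ℕ)
open import Data.Fin using (Fin)
open import Data.Bool using (Bool; true; false)
open import Data.Maybe using (Maybe; just; nothing)
open import Data.Product using (Σ; ∃; ∃-syntax; _×_; _,_)
open import Data.Sum using (_⊎_)
open import Relation.Nullary using (¬_)
open import Relation.Binary.PropositionalEquality using (_≡_; _≢_)
open import Relation.Binary.Bundles using (StrictTotalOrder)
open import Function.Bundles using (_⇔_)

record Graph (n : ℕ) : Set₁ where
  field
    Adj     : Fin n → Fin n → Set
    sym     : ∀ {i j} → Adj i j → Adj j i
    irrefl  : ∀ {i} → ¬ Adj i i

record Ids {c ℓ₁ ℓ₂ : Level} {n : ℕ} (G : Graph n)
           (O : StrictTotalOrder c ℓ₁ ℓ₂) : Set (c ⊔ ℓ₁) where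
  open Graph G
  open StrictTotalOrder O
  field
    ident     : Fin n → Carrier
    distinct1 : ∀ {i j} → Adj i j → ¬ (ident i ≈ ident j)
    distinct2 : ∀ {i j k} → Adj i k → Adj k j → i ≢ j → ¬ (ident i ≈ ident j)

record Config {n : ℕ} (G : Graph n) : Set where
  open Graph G
  field
    m    : Fin n → Bool
    p    : Fin n → Maybe (Fin n)
    p-nb : ∀ {i j} → p i ≡ just j → Adj i j

module Algorithm {c ℓ₁ ℓ₂ : Level} {n : ℕ} {G : Graph n}
                 {O : StrictTotalOrder c ℓ₁ ℓ₂} (I : Ids G O)
                 (C : Config G) where
  open Graph G
  open StrictTotalOrder O using (_<_; _≈_)
  open Ids I
  open Config C

  _>ᵢ_ : Fin n → Fin n → Set ℓ₂
  j >ᵢ i = ident i < ident j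

  _≤ᵢ_ : Fin n → Fin n → Set (ℓ₁ ⊔ ℓ₂)
  j ≤ᵢ i = (ident j < ident i) ⊎ (ident j ≈ ident i)

  PRmarried : Fin n → Set
  PRmarried i = ∃[ j ] (Adj i j × p i ≡ just j × p j ≡ just i)

  mOK : Fin n → Set
  mOK i = (m i ≡ true) ⇔ PRmarried i

  UpdateEnabled : Fin n → Set
  UpdateEnabled i = ¬ mOK i

  MarriageEnabled : Fin n → Set
  MarriageEnabled i =
    mOK i × p i ≡ nothing × (∃[ j ] (Adj i j × p j ≡ just i))

  SeductionEnabled : Fin n → Set ℓ₂
  SeductionEnabled i =
    mOK i × p i ≡ nothing
    × (∀ k → Adj i k → p k ≢ just i)
    × (∃[ j ] (Adj i j × p j ≡ nothing × j >ᵢ i × m j ≡ false))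

  AbandonmentEnabled : Fin n → Set (ℓ₁ ⊔ ℓ₂)
  AbandonmentEnabled i =
    mOK i × (∃[ j ] (p i ≡ just j × p j ≢ just i × (m j ≡ true ⊎ j ≤ᵢ i)))

  Eligible : Fin n → Set (ℓ₁ ⊔ ℓ₂)
  Eligible i = UpdateEnabled i ⊎ MarriageEnabled i ⊎ SeductionEnabled i
               ⊎ AbandonmentEnabled i

  Stable : Set (ℓ₁ ⊔ ℓ₂)
  Stable = ∀ i → ¬ Eligible i

  PRwaiting : Fin n → Set
  PRwaiting i = ∃[ j ] (Adj i j × p i ≡ just j × p j ≢ just i × ¬ PRmarried j)

module Submission where

open import Defs
open import Level using (Level)
open import Data.Nat using (ℕ)
open import Data.Fin using (Fin)
open import Relation.Nullary using (¬_)
open import Relation.Binary.Bundles using (StrictTotalOrder)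

open import Data.Bool using (true)
open import Data.Maybe using (just; nothing)
open import Data.Product using (∃-syntax; _×_; _,_)
open import Data.Sum using (_⊎_; inj₁; inj₂)
open import Data.Fin.Induction using (spo-noetherian)
open import Function.Base using (_∘_)
open import Function.Bundles using (Equivalence)
open import Induction.WellFounded using (WellFounded; Acc; acc)
open import Relation.Binary.Core using (Rel)
open import Relation.Binary.Definitions using (tri<; tri≈; tri>)
open import Relation.Binary.PropositionalEquality using (_≡_; _≢_; refl)
open import Relation.Nullary.Negation using (contradiction)
open import Relation.Unary using (Pred)
import Relation.Binary.Construct.On as On

-- In a stable configuration, if i waits for j then j > i (else i would
-- abandon j), and j is waiting too: p_j ≠ null (else j would marry i),
-- p_{p_j} ≠ j (else j would be married), and m_{p_j} = false (else j would
-- abandon p_j), so p_j is unmarried. Waiting processes thus form an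
-- ascending chain of identifiers, which cannot exist in a finite graph.

wellFounded⇒¬descending : ∀ {a r p} {A : Set a} {_⊏_ : Rel A r} {P : Pred A p} →
                          WellFounded _⊏_ → (∀ {x} → P x → ∃[ y ] (y ⊏ x × P y)) →
                          ∀ x → ¬ P x
wellFounded⇒¬descending {_⊏_ = _⊏_} {P} wf descend x = go (wf x)
  where
  go : ∀ {x} → Acc _⊏_ x → ¬ P x
  go (acc rs) px with descend px
  ... | y , y⊏x , py = go (rs y⊏x) py

module _ {c ℓ₁ ℓ₂ : Level} {n : ℕ} {G : Graph n} {O : StrictTotalOrder c ℓ₁ ℓ₂}
         (I : Ids G O) (C : Config G) where
  open Graph G
  open StrictTotalOrder O using (compare; isStrictPartialOrder; module Eq)
  open Ids I using (ident)
  open Config C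
  open Algorithm I C

  >ᵢ-wellFounded : WellFounded _>ᵢ_
  >ᵢ-wellFounded = spo-noetherian (On.isStrictPartialOrder ident isStrictPartialOrder)

  ≰ᵢ⇒>ᵢ : ∀ {i j} → ¬ (j ≤ᵢ i) → j >ᵢ i
  ≰ᵢ⇒>ᵢ {i} {j} j≰i with compare (ident i) (ident j)
  ... | tri< i<j _ _ = i<j
  ... | tri≈ _ i≈j _ = contradiction (inj₂ (Eq.sym i≈j)) j≰i
  ... | tri> _ _ j<i = contradiction (inj₁ j<i) j≰i

  -- Stability only yields ¬ ¬ mOK i (the negation of Update's guard); this
  -- suffices because every consequence drawn from it below is a negation.
  module _ (stable : Stable) where

    ¬abandoning : ∀ {i j} → p i ≡ just j → p j ≢ just i → ¬ (m j ≡ true ⊎ j ≤ᵢ i)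
    ¬abandoning {i} {j} pi≡j pj≢i abandon =
      stable i (inj₁ λ ok → stable i (inj₂ (inj₂ (inj₂ (ok , j , pi≡j , pj≢i , abandon)))))

    courted⇒p≢nothing : ∀ {i j} → p i ≡ just j → p j ≢ nothing
    courted⇒p≢nothing {i} {j} pi≡j pj≡nothing =
      stable j (inj₁ λ ok → stable j (inj₂ (inj₁ (ok , pj≡nothing , i , sym (p-nb pi≡j) , pi≡j))))

    m≢true⇒¬married : ∀ {k} → m k ≢ true → ¬ PRmarried k
    m≢true⇒¬married {k} mk≢true married =
      stable k (inj₁ λ ok → mk≢true (Equivalence.from ok married))

    waiting⇒waiting-above : ∀ {i} → PRwaiting i → ∃[ j ] (j >ᵢ i × PRwaiting j)
    waiting⇒waiting-above {i} (j , _ , pi≡j , pj≢i , ¬married-j) =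
      j , ≰ᵢ⇒>ᵢ (¬abandoning pi≡j pj≢i ∘ inj₂) , waiting-j
      where
      waiting-j : PRwaiting j
      waiting-j with p j in pj≡
      ... | nothing = contradiction pj≡ (courted⇒p≢nothing pi≡j)
      ... | just k = k , p-nb pj≡ , refl , pk≢j , m≢true⇒¬married (¬abandoning pj≡ pk≢j ∘ inj₁)
        where
        pk≢j : p k ≢ just j
        pk≢j pk≡j = ¬married-j (k , p-nb pj≡ , refl , pk≡j)

lemma3 : ∀ {c ℓ₁ ℓ₂ : Level} {n : ℕ} (G : Graph n) (O : StrictTotalOrder c ℓ₁ ℓ₂)
           (I : Ids G O) (C : Config G) →
           Algorithm.Stable I C → ∀ (i : Fin n) → ¬ Algorithm.PRwaiting I C i
lemma3 G O I C stable =
  wellFounded⇒¬descending (>ᵢ-wellFounded I C) (waiting⇒waiting-above I C stable)
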